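{- Let $\mathsf G$ be an extension of $\mathsf{G3p}$ by ordered box rules and $R$ a rule. If in a proof of a sequent in $\mathsf G+R$ some branch contains two nodes with the same label, then there is an application of $R$ between these two occurrences along the branch.
   Context: Formulas are built from $\top,\bot$ and atoms using $\wedge,\vee,\neg,\to,\Box$, with the usual complexity (each connective and $\Box$ adds 1). A sequent $\Gamma\Rightarrow\Delta$ consists of two finite multisets of formulas; $S^a,S^s$ denote antecedent and succedent; $S_1\cdot S_2=(S_1^a\cup S_2^a\Rightarrow S_1^s\cup S_2^s)$; $\Box\Gamma=\{\Box\varphi:\varphi\in\Gamma\}$, $\Box S=(\Box S^a\Rightarrow\Box S^s)$. $\mathsf{G3p}$ has the rules: axioms $\Gamma,p\Rightarrow p,\Delta$ ($p$ atom) and $\Gamma,\bot\Rightarrow\Delta$; $L\wedge$: $\Gamma,\varphi,\psi\Rightarrow\Delta\,/\,\Gamma,\varphi\wedge\psi\Rightarrow\Delta$; $R\wedge$: $\Gamma\Rightarrow\varphi,\Delta$ and $\Gamma\Rightarrow\psi,\Delta\,/\,\Gamma\Rightarrow\varphi\wedge\psi,\Delta$; $L\vee$: $\Gamma,\varphi\Rightarrow\Delta$ and $\Gamma,\psi\Rightarrow\Delta\,/\,\Gamma,\varphi\vee\psi\Rightarrow\Delta$; $R\vee$: $\Gamma\Rightarrow\varphi,\psi,\Delta\,/\,\Gamma\Rightarrow\varphi\vee\psi,\Delta$; $L\!\to$: $\Gamma\Rightarrow\varphi,\Delta$ and $\Gamma,\psi\Rightarrow\Delta\,/\,\Gamma,\varphi\to\psi\Rightarrow\Delta$;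 $R\!\to$: $\Gamma,\varphi\Rightarrow\psi,\Delta\,/\,\Gamma\Rightarrow\varphi\to\psi,\Delta$. A rule $R$ is a box rule if: (i) its conclusion has the form $\Box S\cdot(\Gamma\Rightarrow\Sigma)$ with multiset variables $\Gamma,\Sigma$ not occurring in $S$ nor in the premisses; (ii) all premisses consist of subformulas of formulas in $S$; (iii) whenever $S_1\ \dots\ S_n/(\Gamma\Rightarrow\Sigma)\cdot\Box(S_0\cdot S_0'\cdot S_0')$ is an instance of $R$, there are $S_i',S_i''$ with $S_i=S_i'\cdot S_i''\cdot S_i''$ such that $S_1'\cdot S_1''\ \dots\ S_n'\cdot S_n''/(\Gamma\Rightarrow\Sigma)\cdot\Box(S_0\cdot S_0')$ is an instance of $R$. Order on sequents: $\Gamma\prec^-_{dm}\Pi$ if $\Gamma$ results from $\Pi$ by replacing one formula by finitely many formulas of lower complexity; $\preccurlyeq_{dm}$ is its reflexive transitive closure; $S_1\preccurlyeq S_2$ iff $S_1^a\cup S_1^s\preccurlyeq_{dm}S_2^a\cup S_2^s$; $S_1\prec S_2$ iff $S_1\preccurlyeq S_2$ and $S_1\neq S_2$. A rule is ordered if in each instance all premisses are $\prec$-lower than the conclusion and consist solely of subformulas of formulas in the conclusion; an extension of $\mathsf{G3p}$ by ordered box rules is $\mathsf{G3p}$ plus finitely many ordered box rules. A proof is a finite tree labelled by sequents in which each inner node with its children is an instance of a rule of the calculus and each leaf is an axiom instance. -}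

module Defs where

open import Data.Nat using (ℕ; zero; suc; _+_; _<_)
open import Data.Fin using (Fin)
open import Data.List using (List; []; _∷_; _++_; map)
open import Data.List.Membership.Propositional using (_∈_)
open import Data.List.Relation.Unary.All using (All)
open import Data.List.Relation.Binary.Pointwise using (Pointwise)
open import Data.List.Relation.Binary.Permutation.Propositional using (_↭_)
open import Relation.Binary.Construct.Closure.ReflexiveTransitive using (Star)
open import Data.Product using (Σ; ∃; _×_; _,_; proj₁; proj₂)
open import Data.Sum using (_⊎_; inj₁; inj₂)
open import Data.Unit using (⊤; tt)
open import Data.Empty using (⊥)
open import Relation.Nullary using (¬_)
open import Relation.Binary.PropositionalEquality using (_≡_)

infixr 6 _∧ᶠ_
infixr 5 _∨ᶠ_
infixr 4 _⊃_
infix  7 ~_ □_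

data Formula : Set where
  top bot : Formula
  atom    : ℕ → Formula
  _∧ᶠ_ _∨ᶠ_ _⊃_ : Formula → Formula → Formula
  ~_ □_   : Formula → Formula

cx : Formula → ℕ
cx top      = 0
cx bot      = 0
cx (atom _) = 0
cx (φ ∧ᶠ ψ) = suc (cx φ + cx ψ)
cx (φ ∨ᶠ ψ) = suc (cx φ + cx ψ)
cx (φ ⊃ ψ)  = suc (cx φ + cx ψ)
cx (~ φ)    = suc (cx φ)
cx (□ φ)    = suc (cx φ)

data _⊑_ : Formula → Formula → Set where
  ⊑-refl : ∀ {φ} → φ ⊑ φ
  ⊑-∧l : ∀ {χ φ ψ} → χ ⊑ φ → χ ⊑ (φ ∧ᶠ ψ)
  ⊑-∧r : ∀ {χ φ ψ} → χ ⊑ ψ → χ ⊑ (φ ∧ᶠ ψ)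
  ⊑-∨l : ∀ {χ φ ψ} → χ ⊑ φ → χ ⊑ (φ ∨ᶠ ψ)
  ⊑-∨r : ∀ {χ φ ψ} → χ ⊑ ψ → χ ⊑ (φ ∨ᶠ ψ)
  ⊑-⊃l : ∀ {χ φ ψ} → χ ⊑ φ → χ ⊑ (φ ⊃ ψ)
  ⊑-⊃r : ∀ {χ φ ψ} → χ ⊑ ψ → χ ⊑ (φ ⊃ ψ)
  ⊑-~  : ∀ {χ φ} → χ ⊑ φ → χ ⊑ (~ φ)
  ⊑-□  : ∀ {χ φ} → χ ⊑ φ → χ ⊑ (□ φ)

-- Sequents: pairs of finite multisets (lists, compared up to permutation)

infix 3 _⇒_
record Seq : Set where
  constructor _⇒_
  field
    ante succ : List Formula
open Seq public

fmls : Seq → List Formula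
fmls S = ante S ++ succ S

infix 2 _≈_
_≈_ : Seq → Seq → Set
S₁ ≈ S₂ = (ante S₁ ↭ ante S₂) × (succ S₁ ↭ succ S₂)

infixl 6 _·_
_·_ : Seq → Seq → Seq
S₁ · S₂ = (ante S₁ ++ ante S₂) ⇒ (succ S₁ ++ succ S₂)

□ˢ : Seq → Seq
□ˢ S = map □_ (ante S) ⇒ map □_ (succ S)

SubSeq : Seq → Seq → Set
SubSeq S₁ S₂ = ∀ {φ} → φ ∈ fmls S₁ → Σ Formula λ ψ → (ψ ∈ fmls S₂) × (φ ⊑ ψ)

-- The (Dershowitz–Manna style) order on sequents

_≺⁻dm_ : List Formula → List Formula → Set
Γ ≺⁻dm Π = Σ Formula λ φ → Σ (List Formula) λ Π₀ → Σ (List Formula) λ Xs →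
  (Π ↭ (φ ∷ Π₀)) × (Γ ↭ (Xs ++ Π₀)) × All (λ x → cx x < cx φ) Xs

_≼dm_ : List Formula → List Formula → Set
_≼dm_ = Star (λ Γ Π → (Γ ↭ Π) ⊎ (Γ ≺⁻dm Π))

_≼_ : Seq → Seq → Set
S₁ ≼ S₂ = fmls S₁ ≼dm fmls S₂

_≺_ : Seq → Seq → Set
S₁ ≺ S₂ = (S₁ ≼ S₂) × ¬ (S₁ ≈ S₂)

Rule : Set₁
Rule = List Seq → Seq → Set

Ordered : Rule → Set
Ordered R = ∀ ps c → R ps c → All (λ p → (p ≺ c) × SubSeq p c) ps

data Axiom : Seq → Set where
  ax-at : ∀ Γ Δ n → Axiom ((atom n ∷ Γ) ⇒ (atom n ∷ Δ))
  ax-⊥  : ∀ Γ Δ → Axiom ((bot ∷ Γ) ⇒ Δ)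

-- G3p logical rules (principal formula written first; multisets are
-- handled up to ↭ when rules are applied, see Applies below)
data G3p : Rule where
  L∧ : ∀ Γ Δ φ ψ → G3p (((φ ∷ ψ ∷ Γ) ⇒ Δ) ∷ []) (((φ ∧ᶠ ψ) ∷ Γ) ⇒ Δ)
  R∧ : ∀ Γ Δ φ ψ → G3p ((Γ ⇒ (φ ∷ Δ)) ∷ (Γ ⇒ (ψ ∷ Δ)) ∷ []) (Γ ⇒ ((φ ∧ᶠ ψ) ∷ Δ))
  L∨ : ∀ Γ Δ φ ψ → G3p (((φ ∷ Γ) ⇒ Δ) ∷ ((ψ ∷ Γ) ⇒ Δ) ∷ []) (((φ ∨ᶠ ψ) ∷ Γ) ⇒ Δ)
  R∨ : ∀ Γ Δ φ ψ → G3p ((Γ ⇒ (φ ∷ ψ ∷ Δ)) ∷ []) (Γ ⇒ ((φ ∨ᶠ ψ) ∷ Δ))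
  L⊃ : ∀ Γ Δ φ ψ → G3p ((Γ ⇒ (φ ∷ Δ)) ∷ ((ψ ∷ Γ) ⇒ Δ) ∷ []) (((φ ⊃ ψ) ∷ Γ) ⇒ Δ)
  R⊃ : ∀ Γ Δ φ ψ → G3p (((φ ∷ Γ) ⇒ (ψ ∷ Δ)) ∷ []) (Γ ⇒ ((φ ⊃ ψ) ∷ Δ))

-- instances generated by a "core" relation (premisses, S):
-- conclusion □S · (Γ ⇒ Σ) with Γ, Σ arbitrary context not occurring
-- in S or the premisses (condition (i))
BoxInst : Rule → Rule
BoxInst Core ps c = Σ Seq λ S → Σ Seq λ C → Core ps S × (c ≈ (□ˢ S · C))

record BoxRule : Set₁ where
  field
    Core : Rule
    subformulas : ∀ ps S → Core ps S → All (λ p → SubSeq p S) ps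
    -- (iii) closure under contraction of the boxed part
    contraction : ∀ ps C S₀ S₀' →
      BoxInst Core ps (C · □ˢ (S₀ · S₀' · S₀')) →
      Σ (List (Seq × Seq)) λ ds →
        Pointwise (λ p d → p ≈ (proj₁ d · proj₂ d · proj₂ d)) ps ds ×
        BoxInst Core (map (λ d → proj₁ d · proj₂ d) ds) (C · □ˢ (S₀ · S₀'))

  inst : Rule
  inst = BoxInst Core

data Tree (I : Set) : Set where
  leaf : Seq → Tree I
  node : I → Seq → Tree I → List (Tree I) → Tree I   -- at least one child

label : ∀ {I} → Tree I → Seq
label (leaf s)       = s
label (node _ s _ _) = s

Applies : Rule → List Seq → Seq → Set
Applies R ps c = Σ (List Seq) λ ps' → Σ Seq λ c' →
  R ps' c' × Pointwise _≈_ ps ps' × (c ≈ c')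

IsAxiom : Seq → Set
IsAxiom s = Σ Seq λ s' → Axiom s' × (s ≈ s')

data Proof {I : Set} (rules : I → Rule) : Tree I → Set where
  leaf : ∀ {s} → IsAxiom s → Proof rules (leaf s)
  node : ∀ {i s t ts} → Applies (rules i) (map label (t ∷ ts)) s →
         All (Proof rules) (t ∷ ts) → Proof rules (node i s t ts)

-- u is a child of t (proof-relevant: records the position)
data Child {I : Set} : Tree I → Tree I → Set where
  child : ∀ {i s t ts u} → u ∈ (t ∷ ts) → Child (node i s t ts) u

data Path {I : Set} : Tree I → Tree I → Set where
  stop : ∀ {t} → Path t t
  step : ∀ {t v u} → Child t v → Path v u → Path t u

TaggedBy : ∀ {I} → (I → Set) → Tree I → Set
TaggedBy P (leaf _)       = ⊥
TaggedBy P (node i _ _ _) = P i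

-- some node on the path, from its start (inclusive) to its end
-- (exclusive), is an application of a rule satisfying P
data AppliedOn {I : Set} (P : I → Set) : {t u : Tree I} → Path t u → Set where
  here  : ∀ {t v u} (c : Child t v) (p : Path v u) → TaggedBy P t → AppliedOn P (step c p)
  there : ∀ {t v u} (c : Child t v) {p : Path v u} → AppliedOn P p → AppliedOn P (step c p)

data Tag (k : ℕ) : Set where
  g3p : Tag k
  box : Fin k → Tag k
  newR : Tag k

GplusR : ∀ {k} → (Fin k → BoxRule) → Rule → Tag k → Rule
GplusR B R g3p     = G3p
GplusR B R (box j) = BoxRule.inst (B j)
GplusR B R newR    = R

IsNewR : ∀ {k} → Tag k → Set
IsNewR newR = ⊤
IsNewR _    = ⊥

-- Measure a sequent by the multiset of the complexities of its formulas.
-- Every rule of G strictly decreases this measure in the multiset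
-- ordering: a G3p premiss replaces the principal formula by formulas of
-- lower complexity, and a premiss of an ordered box rule lies ≼-below its
-- conclusion without having the same measure, because the conclusion
-- contains □φ for a formula φ of maximal complexity in the boxed part,
-- which no premiss (built from subformulas of that part) can reach.
-- The multiset ordering on ℕ compares the numbers of formulas at the
-- highest complexity at which they differ; it is transitive and
-- irreflexive, so the label of a node can only recur below it after an
-- application of R.
module Submission where

open import Defs
open import Data.Nat using (ℕ; suc; _+_; _<_; _≤_; _≟_; s≤s)
open import Data.Nat.Properties
  using ( ≤-totalOrder; module ≤-Reasoning; ≤-refl; ≤-trans; <⇒≤; <⇒≢; <-irrefl; <-trans; <-cmp
        ; n≤1+n; n<1+n; m≤m+n; m≤n+m)
open import Data.List.Extrema ≤-totalOrder using (argmax; argmax-sel; f[⊥]≤f[argmax]; f[xs]≤f[argmax])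
open import Data.Fin using (Fin)
open import Data.List using (List; []; _∷_; _++_; map; length; filter)
open import Data.List.Properties using (length-++; filter-++; filter-none; filter-some; filter-accept; filter-reject; ++-conicalˡ; ++-conicalʳ)
open import Data.List.Membership.Propositional using (_∈_)
open import Data.List.Membership.Propositional.Properties using (∈-map⁺; ∈-++⁺ˡ; ∈-++⁺ʳ; ∈-++⁻)
open import Data.List.Relation.Unary.All as All using (All; []; _∷_)
open import Data.List.Relation.Unary.Any as Any using (here; there)
open import Data.List.Relation.Unary.Any.Properties using (¬Any[])
open import Data.List.Relation.Binary.Pointwise using (Pointwise; []; _∷_)
open import Data.List.Relation.Binary.Permutation.Propositional using (_↭_; ↭-refl; prep)
open import Data.List.Relation.Binary.Permutation.Propositional.Properties
  using (↭-length; filter-↭; shift; shifts)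
open import Relation.Binary.Construct.Closure.ReflexiveTransitive using (ε; _◅_)
open import Data.Product using (∃; _×_; _,_)
open import Data.Sum using (_⊎_; inj₁; inj₂; [_,_]′)
open import Data.Unit using (tt)
open import Data.Empty using (⊥-elim)
open import Relation.Nullary using (¬_; Dec)
open import Relation.Binary.PropositionalEquality
  using (_≡_; _≢_; refl; sym; trans; cong; cong₂; subst; subst₂; module ≡-Reasoning)
open import Relation.Binary using (tri<; tri≈; tri>)

cx-<ˡ : ∀ {φ ψ} → cx φ < suc (cx φ + cx ψ)
cx-<ˡ {φ} {ψ} = s≤s (m≤m+n (cx φ) (cx ψ))

cx-<ʳ : ∀ {φ ψ} → cx ψ < suc (cx φ + cx ψ)
cx-<ʳ {φ} {ψ} = s≤s (m≤n+m (cx ψ) (cx φ))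

⊑⇒cx≤ : ∀ {φ ψ} → φ ⊑ ψ → cx φ ≤ cx ψ
⊑⇒cx≤ ⊑-refl     = ≤-refl
⊑⇒cx≤ (⊑-∧l sub) = ≤-trans (⊑⇒cx≤ sub) (<⇒≤ cx-<ˡ)
⊑⇒cx≤ (⊑-∧r sub) = ≤-trans (⊑⇒cx≤ sub) (<⇒≤ cx-<ʳ)
⊑⇒cx≤ (⊑-∨l sub) = ≤-trans (⊑⇒cx≤ sub) (<⇒≤ cx-<ˡ)
⊑⇒cx≤ (⊑-∨r sub) = ≤-trans (⊑⇒cx≤ sub) (<⇒≤ cx-<ʳ)
⊑⇒cx≤ (⊑-⊃l sub) = ≤-trans (⊑⇒cx≤ sub) (<⇒≤ cx-<ˡ)
⊑⇒cx≤ (⊑-⊃r sub) = ≤-trans (⊑⇒cx≤ sub) (<⇒≤ cx-<ʳ)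
⊑⇒cx≤ (⊑-~ sub)  = ≤-trans (⊑⇒cx≤ sub) (n≤1+n _)
⊑⇒cx≤ (⊑-□ sub)  = ≤-trans (⊑⇒cx≤ sub) (n≤1+n _)

maximal : (xs : List Formula) →
          xs ≡ [] ⊎ ∃ λ μ → μ ∈ xs × All (λ x → cx x ≤ cx μ) xs
maximal []         = inj₁ refl
maximal (ψ ∷ rest) =
  inj₂ (argmax cx ψ rest , [ here , there ]′ (argmax-sel cx ψ rest) ,
        f[⊥]≤f[argmax] {f = cx} ψ rest ∷ f[xs]≤f[argmax] {f = cx} ψ rest)

cx≟ : (d : ℕ) (x : Formula) → Dec (cx x ≡ d)
cx≟ d x = cx x ≟ d

count : ℕ → List Formula → ℕ
count d xs = length (filter (cx≟ d) xs)

count-++ : ∀ d xs ys → count d (xs ++ ys) ≡ count d xs + count d ys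
count-++ d xs ys = trans (cong length (filter-++ (cx≟ d) xs ys)) (length-++ (filter (cx≟ d) xs))

count-↭ : ∀ d {xs ys} → xs ↭ ys → count d xs ≡ count d ys
count-↭ d xs↭ys = ↭-length (filter-↭ (cx≟ d) xs↭ys)

count-below : ∀ {d xs} → All (λ x → cx x < d) xs → count d xs ≡ 0
count-below {d} below = cong length (filter-none (cx≟ d) (All.map (λ x<d → <⇒≢ x<d) below))

count-∈ : ∀ {x xs} → x ∈ xs → 0 < count (cx x) xs
count-∈ {x} x∈xs = filter-some (cx≟ (cx x)) (Any.map (λ x≡y → cong cx (sym x≡y)) x∈xs)

count-here : ∀ x xs → count (cx x) (x ∷ xs) ≡ suc (count (cx x) xs)
count-here x xs = cong length (filter-accept (cx≟ (cx x)) {x} {xs} refl)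

count-elsewhere : ∀ {d} x xs → cx x ≢ d → count d (x ∷ xs) ≡ count d xs
count-elsewhere {d} x xs x≢d = cong length (filter-reject (cx≟ d) {x} {xs} x≢d)

infix 4 _=ₘ_ _<ₘ_ _≤ₘ_

record _=ₘ_ (xs ys : List Formula) : Set where
  constructor same-counts
  field
    count-≡ : ∀ d → count d xs ≡ count d ys
open _=ₘ_

record _<ₘ_ (xs ys : List Formula) : Set where
  constructor at-level
  field
    level       : ℕ
    fewer       : count level xs < count level ys
    agree-above : ∀ d → level < d → count d xs ≡ count d ys

_≤ₘ_ : List Formula → List Formula → Set
xs ≤ₘ ys = xs <ₘ ys ⊎ xs =ₘ ys

=ₘ-refl : ∀ {xs} → xs =ₘ xs
=ₘ-refl = same-counts λ _ → refl

=ₘ-sym : ∀ {xs ys} → xs =ₘ ys → ys =ₘ xs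
=ₘ-sym xs=ys = same-counts λ d → sym (count-≡ xs=ys d)

=ₘ-trans : ∀ {xs ys zs} → xs =ₘ ys → ys =ₘ zs → xs =ₘ zs
=ₘ-trans xs=ys ys=zs = same-counts λ d → trans (count-≡ xs=ys d) (count-≡ ys=zs d)

↭⇒=ₘ : ∀ {xs ys} → xs ↭ ys → xs =ₘ ys
↭⇒=ₘ xs↭ys = same-counts λ d → count-↭ d xs↭ys

≈⇒=ₘ : ∀ {S₁ S₂} → S₁ ≈ S₂ → fmls S₁ =ₘ fmls S₂
≈⇒=ₘ {S₁} {S₂} (ante↭ , succ↭) = same-counts λ d → begin
  count d (ante S₁ ++ succ S₁)          ≡⟨ count-++ d (ante S₁) (succ S₁) ⟩
  count d (ante S₁) + count d (succ S₁) ≡⟨ cong₂ _+_ (count-↭ d ante↭) (count-↭ d succ↭) ⟩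
  count d (ante S₂) + count d (succ S₂) ≡⟨ count-++ d (ante S₂) (succ S₂) ⟨
  count d (ante S₂ ++ succ S₂)          ∎
  where open ≡-Reasoning

=ₘ-[] : ∀ {xs} → xs =ₘ [] → xs ≡ []
=ₘ-[] {[]}    _      = refl
=ₘ-[] {x ∷ xs} x∷xs=[] = ⊥-elim (<-irrefl (sym (count-≡ x∷xs=[] (cx x))) (count-∈ {xs = x ∷ xs} (here refl)))

<ₘ-irrefl : ∀ {xs ys} → xs <ₘ ys → ¬ xs =ₘ ys
<ₘ-irrefl (at-level d fewer _) xs=ys = <-irrefl (count-≡ xs=ys d) fewer

<ₘ-resp-=ₘ : ∀ {xs xs′ ys ys′} → xs =ₘ xs′ → ys =ₘ ys′ → xs <ₘ ys → xs′ <ₘ ys′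
<ₘ-resp-=ₘ xs=xs′ ys=ys′ (at-level d fewer above) =
  at-level d (subst₂ _<_ (count-≡ xs=xs′ d) (count-≡ ys=ys′ d) fewer)
    λ e d<e → trans (sym (count-≡ xs=xs′ e)) (trans (above e d<e) (count-≡ ys=ys′ e))

<ₘ-trans : ∀ {xs ys zs} → xs <ₘ ys → ys <ₘ zs → xs <ₘ zs
<ₘ-trans (at-level d₁ fewer₁ above₁) (at-level d₂ fewer₂ above₂) with <-cmp d₁ d₂
... | tri< d₁<d₂ _ _ = at-level d₂ (subst (_< _) (sym (above₁ d₂ d₁<d₂)) fewer₂)
                         λ e d₂<e → trans (above₁ e (<-trans d₁<d₂ d₂<e)) (above₂ e d₂<e)
... | tri≈ _ refl _  = at-level d₁ (<-trans fewer₁ fewer₂)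
                         λ e d<e → trans (above₁ e d<e) (above₂ e d<e)
... | tri> _ _ d₂<d₁ = at-level d₁ (subst (_ <_) (above₂ d₁ d₂<d₁) fewer₁)
                         λ e d₁<e → trans (above₁ e d₁<e) (above₂ e (<-trans d₂<d₁ d₁<e))

<ₘ-≤ₘ-trans : ∀ {xs ys zs} → xs <ₘ ys → ys ≤ₘ zs → xs <ₘ zs
<ₘ-≤ₘ-trans xs<ys (inj₁ ys<zs) = <ₘ-trans xs<ys ys<zs
<ₘ-≤ₘ-trans xs<ys (inj₂ ys=zs) = <ₘ-resp-=ₘ =ₘ-refl ys=zs xs<ys

=ₘ-≤ₘ-trans : ∀ {xs ys zs} → xs =ₘ ys → ys ≤ₘ zs → xs ≤ₘ zs
=ₘ-≤ₘ-trans xs=ys (inj₁ ys<zs) = inj₁ (<ₘ-resp-=ₘ (=ₘ-sym xs=ys) =ₘ-refl ys<zs)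
=ₘ-≤ₘ-trans xs=ys (inj₂ ys=zs) = inj₂ (=ₘ-trans xs=ys ys=zs)

replace-<ₘ : ∀ {φ Xs} Π₀ → All (λ x → cx x < cx φ) Xs → Xs ++ Π₀ <ₘ φ ∷ Π₀
replace-<ₘ {φ} {Xs} Π₀ lower = at-level (cx φ) fewer above
  where
  fewer : count (cx φ) (Xs ++ Π₀) < count (cx φ) (φ ∷ Π₀)
  fewer = begin-strict
    count (cx φ) (Xs ++ Π₀)              ≡⟨ count-++ (cx φ) Xs Π₀ ⟩
    count (cx φ) Xs + count (cx φ) Π₀    ≡⟨ cong (_+ count (cx φ) Π₀) (count-below lower) ⟩
    count (cx φ) Π₀                      <⟨ n<1+n _ ⟩
    suc (count (cx φ) Π₀)                ≡⟨ count-here φ Π₀ ⟨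
    count (cx φ) (φ ∷ Π₀)                ∎
    where open ≤-Reasoning

  above : ∀ d → cx φ < d → count d (Xs ++ Π₀) ≡ count d (φ ∷ Π₀)
  above d φ<d = begin
    count d (Xs ++ Π₀)         ≡⟨ count-++ d Xs Π₀ ⟩
    count d Xs + count d Π₀    ≡⟨ cong (_+ count d Π₀) (count-below (All.map (λ x<φ → <-trans x<φ φ<d) lower)) ⟩
    count d Π₀                 ≡⟨ count-elsewhere φ Π₀ (<⇒≢ φ<d) ⟨
    count d (φ ∷ Π₀)           ∎
    where open ≡-Reasoning

≺⁻dm⇒<ₘ : ∀ {Γ Π} → Γ ≺⁻dm Π → Γ <ₘ Π
≺⁻dm⇒<ₘ (φ , Π₀ , Xs , Π↭ , Γ↭ , lower) =
  <ₘ-resp-=ₘ (=ₘ-sym (↭⇒=ₘ Γ↭)) (=ₘ-sym (↭⇒=ₘ Π↭)) (replace-<ₘ Π₀ lower)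

≼dm⇒≤ₘ : ∀ {Γ Π} → Γ ≼dm Π → Γ ≤ₘ Π
≼dm⇒≤ₘ ε                 = inj₂ =ₘ-refl
≼dm⇒≤ₘ (inj₁ Γ↭Δ ◅ Δ≼Π) = =ₘ-≤ₘ-trans (↭⇒=ₘ Γ↭Δ) (≼dm⇒≤ₘ Δ≼Π)
≼dm⇒≤ₘ (inj₂ Γ≺Δ ◅ Δ≼Π) = inj₁ (<ₘ-≤ₘ-trans (≺⁻dm⇒<ₘ Γ≺Δ) (≼dm⇒≤ₘ Δ≼Π))

G3p-premiss-≺⁻dm : ∀ {ps c p} → G3p ps c → p ∈ ps → fmls p ≺⁻dm fmls c
G3p-premiss-≺⁻dm (L∧ Γ Δ φ ψ) (here refl) =
  φ ∧ᶠ ψ , Γ ++ Δ , φ ∷ ψ ∷ [] , ↭-refl , ↭-refl , cx-<ˡ ∷ cx-<ʳ ∷ []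
G3p-premiss-≺⁻dm (R∧ Γ Δ φ ψ) (here refl) =
  φ ∧ᶠ ψ , Γ ++ Δ , φ ∷ [] , shift _ Γ Δ , shift φ Γ Δ , cx-<ˡ ∷ []
G3p-premiss-≺⁻dm (R∧ Γ Δ φ ψ) (there (here refl)) =
  φ ∧ᶠ ψ , Γ ++ Δ , ψ ∷ [] , shift _ Γ Δ , shift ψ Γ Δ , cx-<ʳ ∷ []
G3p-premiss-≺⁻dm (L∨ Γ Δ φ ψ) (here refl) =
  φ ∨ᶠ ψ , Γ ++ Δ , φ ∷ [] , ↭-refl , ↭-refl , cx-<ˡ ∷ []
G3p-premiss-≺⁻dm (L∨ Γ Δ φ ψ) (there (here refl)) =
  φ ∨ᶠ ψ , Γ ++ Δ , ψ ∷ [] , ↭-refl , ↭-refl , cx-<ʳ ∷ []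
G3p-premiss-≺⁻dm (R∨ Γ Δ φ ψ) (here refl) =
  φ ∨ᶠ ψ , Γ ++ Δ , φ ∷ ψ ∷ [] , shift _ Γ Δ , shifts Γ (φ ∷ ψ ∷ []) , cx-<ˡ ∷ cx-<ʳ ∷ []
G3p-premiss-≺⁻dm (L⊃ Γ Δ φ ψ) (here refl) =
  (φ ⊃ ψ) , Γ ++ Δ , φ ∷ [] , ↭-refl , shift φ Γ Δ , cx-<ˡ ∷ []
G3p-premiss-≺⁻dm (L⊃ Γ Δ φ ψ) (there (here refl)) =
  (φ ⊃ ψ) , Γ ++ Δ , ψ ∷ [] , ↭-refl , ↭-refl , cx-<ʳ ∷ []
G3p-premiss-≺⁻dm (R⊃ Γ Δ φ ψ) (here refl) =
  (φ ⊃ ψ) , Γ ++ Δ , φ ∷ ψ ∷ [] , shift _ Γ Δ , prep φ (shift ψ Γ Δ) , cx-<ˡ ∷ cx-<ʳ ∷ []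

Descending : Rule → Set
Descending R = ∀ {ps c} → R ps c → All (λ p → fmls p <ₘ fmls c) ps

G3p-descending : Descending G3p
G3p-descending r = All.tabulate λ p∈ps → ≺⁻dm⇒<ₘ (G3p-premiss-≺⁻dm r p∈ps)

□∈□ˢ· : ∀ {φ} S C → φ ∈ fmls S → □ φ ∈ fmls (□ˢ S · C)
□∈□ˢ· S C φ∈S with ∈-++⁻ (ante S) φ∈S
... | inj₁ φ∈ante = ∈-++⁺ˡ (∈-++⁺ˡ (∈-map⁺ □_ φ∈ante))
... | inj₂ φ∈succ = ∈-++⁺ʳ (map □_ (ante S) ++ ante C) (∈-++⁺ˡ (∈-map⁺ □_ φ∈succ))

empty-≈ : ∀ {S₁ S₂} → fmls S₁ ≡ [] → fmls S₂ ≡ [] → S₁ ≈ S₂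
empty-≈ {Γ₁ ⇒ Δ₁} {Γ₂ ⇒ Δ₂} S₁≡[] S₂≡[]
  with ++-conicalˡ Γ₁ Δ₁ S₁≡[] | ++-conicalʳ Γ₁ Δ₁ S₁≡[]
     | ++-conicalˡ Γ₂ Δ₂ S₂≡[] | ++-conicalʳ Γ₂ Δ₂ S₂≡[]
... | refl | refl | refl | refl = ↭-refl , ↭-refl

-- Equal counts are impossible unless S, and with it both sequents, is empty.
boxed-=ₘ⇒≈ : ∀ {p c} S C → SubSeq p S → c ≈ □ˢ S · C → fmls p =ₘ fmls c → p ≈ c
boxed-=ₘ⇒≈ {p} {c} S C p⊑S c≈ p=c with maximal (fmls S)
... | inj₁ S≡[] = empty-≈ p≡[] (=ₘ-[] (subst (fmls c =ₘ_) p≡[] (=ₘ-sym p=c)))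
  where
  p≡[] : fmls p ≡ []
  p≡[] = =ₘ-[] (same-counts λ d → count-below (All.tabulate λ φ∈p →
    let ψ , ψ∈S , _ = p⊑S φ∈p in ⊥-elim (¬Any[] (subst (_ ∈_) S≡[] ψ∈S))))
... | inj₂ (μ , μ∈S , μ-max) = ⊥-elim (<-irrefl (sym no-p-at-level) some-p-at-level)
  where
  level : ℕ
  level = suc (cx μ)

  no-p-at-level : count level (fmls p) ≡ 0
  no-p-at-level = count-below (All.tabulate λ φ∈p →
    let ψ , ψ∈S , φ⊑ψ = p⊑S φ∈p in s≤s (≤-trans (⊑⇒cx≤ φ⊑ψ) (All.lookup μ-max ψ∈S)))

  some-p-at-level : 0 < count level (fmls p)
  some-p-at-level = subst (0 <_) (sym (trans (count-≡ p=c level) (count-≡ (≈⇒=ₘ c≈) level)))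
                          (count-∈ (□∈□ˢ· S C μ∈S))

box-premiss-<ₘ : ∀ {p c} S C → SubSeq p S → c ≈ □ˢ S · C → p ≺ c → fmls p <ₘ fmls c
box-premiss-<ₘ S C p⊑S c≈ (p≼c , p≉c) with ≼dm⇒≤ₘ p≼c
... | inj₁ p<c = p<c
... | inj₂ p=c = ⊥-elim (p≉c (boxed-=ₘ⇒≈ S C p⊑S c≈ p=c))

ordered-box-descending : (B : BoxRule) → Ordered (BoxRule.inst B) → Descending (BoxRule.inst B)
ordered-box-descending B ordered {ps} {c} r@(S , C , core , c≈) = All.tabulate λ p∈ps →
  let p≺c , _ = All.lookup (ordered ps c r) p∈ps
  in box-premiss-<ₘ S C (All.lookup (BoxRule.subformulas B ps S core) p∈ps) c≈ p≺c

Applies-descending : ∀ {R ps c} → Descending R → Applies R ps c → All (λ p → fmls p <ₘ fmls c) ps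
Applies-descending {c = c} descending (ps′ , c′ , r , ps≈ps′ , c≈c′) = transport ps≈ps′ (descending r)
  where
  transport : ∀ {qs qs′} → Pointwise _≈_ qs qs′ →
              All (λ q → fmls q <ₘ fmls c′) qs′ → All (λ q → fmls q <ₘ fmls c) qs
  transport []               []             = []
  transport (q≈q′ ∷ qs≈qs′) (q′<c′ ∷ qs′<c′) =
    <ₘ-resp-=ₘ (=ₘ-sym (≈⇒=ₘ q≈q′)) (=ₘ-sym (≈⇒=ₘ c≈c′)) q′<c′ ∷ transport qs≈qs′ qs′<c′

module _ {I : Set} {rules : I → Rule} where

  Proof-child : ∀ {t v} → Proof rules t → Child t v → Proof rules v
  Proof-child (node _ subproofs) (child v∈) = All.lookup subproofs v∈

  Proof-path : ∀ {t u} → Proof rules t → Path t u → Proof rules u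
  Proof-path proof stop       = proof
  Proof-path proof (step c q) = Proof-path (Proof-child proof c) q

  module _ {P : I → Set} (P-or-descending : ∀ i → P i ⊎ Descending (rules i)) where

    child-descends : ∀ {t v} → Proof rules t → Child t v →
                     TaggedBy P t ⊎ fmls (label v) <ₘ fmls (label t)
    child-descends (node {i} applies _) (child v∈) with P-or-descending i
    ... | inj₁ Pi         = inj₁ Pi
    ... | inj₂ descending = inj₂ (All.lookup (Applies-descending descending applies) (∈-map⁺ label v∈))

    path-descends : ∀ {t v u} → Proof rules t → (c : Child t v) (q : Path v u) →
                    AppliedOn P (step c q) ⊎ fmls (label u) <ₘ fmls (label t)
    path-descends proof c q with child-descends proof c
    ... | inj₁ tagged = inj₁ (here c q tagged)
    path-descends proof c stop         | inj₂ v<t = inj₂ v<t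
    path-descends proof c (step c′ q′) | inj₂ v<t with path-descends (Proof-child proof c) c′ q′
    ... | inj₁ applied = inj₁ (there c applied)
    ... | inj₂ u<v     = inj₂ (<ₘ-trans u<v v<t)

GplusR-newR-or-descending : ∀ {k} (B : Fin k → BoxRule) → (∀ j → Ordered (BoxRule.inst (B j))) →
                            (R : Rule) → ∀ i → IsNewR i ⊎ Descending (GplusR B R i)
GplusR-newR-or-descending B ordered R g3p     = inj₂ G3p-descending
GplusR-newR-or-descending B ordered R (box j) = inj₂ (ordered-box-descending (B j) (ordered j))
GplusR-newR-or-descending B ordered R newR    = inj₁ tt

lemma4p1 : (k : ℕ) (B : Fin k → BoxRule) → (∀ j → Ordered (BoxRule.inst (B j))) →
           (R : Rule) (t : Tree (Tag k)) → Proof (GplusR B R) t →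
           ∀ {t₁ v t₂} → Path t t₁ → (c : Child t₁ v) (q : Path v t₂) →
           label t₁ ≈ label t₂ → AppliedOn IsNewR (step c q)
lemma4p1 k B ordered R t proof p c q t₁≈t₂
  with path-descends (GplusR-newR-or-descending B ordered R) (Proof-path proof p) c q
... | inj₁ applied = applied
... | inj₂ t₂<t₁   = ⊥-elim (<ₘ-irrefl t₂<t₁ (=ₘ-sym (≈⇒=ₘ t₁≈t₂)))
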